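{- Let $(D,r)$ be a connected rooted digraph in which the head of every cut-edge has in-degree $1$. Let $u\ne r$ be a vertex such that $r\notin N^-(u)$ and there is no vertex $v\in N^-(u)$ such that $u$ is unreachable from $r$ in $D-v$. Let $D'$ be obtained from $D$ by shortcutting $u$. Then no new cut-edges appear: every cut-edge of $D'$ is an arc of $D$ that is a cut-edge of $D$.
   Context: A rooted digraph $(D,r)$ is a finite digraph without loops or parallel arcs with a root $r$ of in-degree $0$; it is connected if every vertex is reachable from $r$. A cut-edge is an arc $e$ such that some vertex is unreachable from $r$ in the digraph minus $e$. $N^-(u)$ is the set of in-neighbours of $u$. Shortcutting a vertex $u\ne r$ means deleting $u$ and adding an arc $(x,y)$ for every directed path $(x,u,y)$ in $D$ (with $x\ne y$), without creating parallel arcs. -}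

module Defs where

open import Data.Nat using (ℕ)
open import Data.Fin using (Fin)
open import Data.Bool using (Bool; true)
open import Data.Product using (Σ; ∃; _×_; _,_; proj₁)
open import Data.Sum using (_⊎_)
open import Relation.Nullary using (¬_)
open import Relation.Binary.PropositionalEquality using (_≡_; _≢_)

Rel : Set → Set₁
Rel V = V → V → Set

data Reach {V : Set} (E : Rel V) : V → V → Set where
  here : ∀ {x} → Reach E x x
  step : ∀ {x y z} → E x y → Reach E y z → Reach E x z

Connected : {V : Set} → Rel V → V → Set
Connected E r = ∀ x → Reach E r x

RemoveArc : {V : Set} → Rel V → V → V → Rel V
RemoveArc E a b x y = E x y × ¬ (x ≡ a × y ≡ b)

-- digraph minus the vertex v (v is isolated; it is never the target in our uses)
RemoveVertex : {V : Set} → Rel V → V → Rel V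
RemoveVertex E v x y = E x y × x ≢ v × y ≢ v

IsCutEdge : {V : Set} → Rel V → V → V → V → Set
IsCutEdge E r a b = E a b × ∃ λ x → ¬ Reach (RemoveArc E a b) r x

InDegOne : {V : Set} → Rel V → V → Set
InDegOne E b = ∃ λ x → E x b × (∀ y → E y b → y ≡ x)

Arc : {n : ℕ} → (Fin n → Fin n → Bool) → Rel (Fin n)
Arc A x y = A x y ≡ true

Loopless : {V : Set} → Rel V → Set
Loopless E = ∀ x → ¬ E x x

VMinus : {n : ℕ} → Fin n → Set
VMinus {n} u = Σ (Fin n) (λ x → x ≢ u)

Shortcut : {V : Set} → Rel V → (u : V) → Rel (Σ V (λ x → x ≢ u))
Shortcut E u (x , _) (y , _) = E x y ⊎ (E x u × E u y × x ≢ y)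

module Submission where

-- Write D' for the shortcut digraph, a = (a₀,_) and
-- b = (b₀,_) for the ends of the given cut-edge of D', and D'' = D' − (a,b).
-- Every walk of D that never uses the arc (a₀,b₀) can be lifted, vertex by
-- vertex, to a walk of D'' from the root: a visit of u is skipped by a
-- shortcut arc (p,u,z), where p is an in-neighbour of u already reached in
-- D''.  Such a shortcut arc differs from (a,b) as soon as p ≢ a₀, so the
-- lifting works whenever there is a "safe entry" into u, i.e. an in-neighbour
-- p ≢ a₀ of u reached in D''.  If a₀ → u is an arc, a safe entry exists
-- because u is still reachable in D − a₀ (lifting that walk gives one);
-- otherwise every in-neighbour of u is safe.
-- Consequently the vertex x that D'' cannot reach is not reachable in
-- D − (a₀,b₀); and (a₀,b₀) is an arc of D, since otherwise D itself avoids
-- it and x, reachable in D, would be reachable in D''.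

open import Defs
open import Data.Nat using (ℕ)
open import Data.Fin using (Fin)
open import Data.Bool using (Bool; true)
import Data.Bool as Bool
import Data.Fin as Fin
open import Data.Product using (Σ; ∃; _×_; _,_; proj₁; proj₂)
open import Data.Sum using (_⊎_; inj₁; inj₂)
open import Data.Empty using (⊥-elim)
open import Function using (id)
open import Relation.Nullary using (¬_; yes; no)
open import Relation.Nullary.Decidable using (decidable-stable)
open import Relation.Binary.Definitions using (DecidableEquality)
open import Relation.Binary.PropositionalEquality using (_≡_; _≢_; refl; sym; cong)

snoc : {V : Set} {F : Rel V} {x y z : V} → Reach F x y → F y z → Reach F x z
snoc here f = step f here
snoc (step g w) f = step g (snoc w f)

Avoids : {V : Set} → Rel V → V → V → Set
Avoids F a₀ b₀ = ∀ {y z} → F y z → ¬ (y ≡ a₀ × z ≡ b₀)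

module ShortcutLifting {V : Set} (_≟_ : DecidableEquality V) (E : Rel V)
                       (loopless : Loopless E) (r u : V) (ur : u ≢ r)
                       (a b : Σ V (λ x → x ≢ u)) where

  a₀ b₀ : V
  a₀ = proj₁ a
  b₀ = proj₁ b

  r' : Σ V (λ x → x ≢ u)
  r' = r , λ e → ur (sym e)

  D'' : Rel (Σ V (λ x → x ≢ u))
  D'' = RemoveArc (Shortcut E u) a b

  Reached : V → Set
  Reached y = (py : y ≢ u) → Reach D'' r' (y , py)

  SafeEntry : Set
  SafeEntry = ∃ λ p → Reached p × E p u × p ≢ a₀

  Lifted : V → Set
  Lifted y = Reached y × (y ≡ u → SafeEntry)

  rootLifted : Lifted r
  rootLifted = (λ _ → here) , (λ e → ⊥-elim (ur (sym e)))

  module Lift (F : Rel V) (F⊆E : ∀ {y z} → F y z → E y z)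
              (avoids : Avoids F a₀ b₀)
              (entry : ∀ {y} → F y u → Reached y → SafeEntry) where

    liftArc : ∀ {y z} → Lifted y → F y z → Lifted z
    liftArc {y} {z} (reachedY , bypassY) f with z ≟ u
    ... | yes refl = (λ u≢u → ⊥-elim (u≢u refl)) , (λ _ → entry f reachedY)
    ... | no z≢u with y ≟ u
    ...   | no y≢u = (λ _ → snoc (reachedY y≢u) (inj₁ (F⊆E f) , notAB)) , (λ e → ⊥-elim (z≢u e))
      where
        notAB : ¬ ((y , y≢u) ≡ a × (z , z≢u) ≡ b)
        notAB (e₁ , e₂) = avoids f (cong proj₁ e₁ , cong proj₁ e₂)
    ...   | yes refl = (λ _ → viaEntry (bypassY refl)) , (λ e → ⊥-elim (z≢u e))
      where
        -- skip u by the shortcut arc (p,u,z), unless p is z itself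
        viaEntry : SafeEntry → Reach D'' r' (z , z≢u)
        viaEntry (p , reachedP , pu , p≢a₀) with p ≟ z
        ... | yes refl = reachedP z≢u
        ... | no p≢z = snoc (reachedP p≢u) (inj₂ (pu , F⊆E f , p≢z) , λ (e₁ , _) → p≢a₀ (cong proj₁ e₁))
          where
            p≢u : p ≢ u
            p≢u refl = loopless u pu

    liftWalk : ∀ {s t} → Reach F s t → Lifted s → Lifted t
    liftWalk here l = l
    liftWalk (step f w) l = liftWalk w (liftArc l f)

  safeEntryFromSeparation : Reach (RemoveVertex E a₀) r u → SafeEntry
  safeEntryFromSeparation w = proj₂ (Lift.liftWalk (RemoveVertex E a₀) proj₁ avoids entry w rootLifted) refl
    where
      avoids : Avoids (RemoveVertex E a₀) a₀ b₀
      avoids (_ , y≢a₀ , _) (y≡a₀ , _) = y≢a₀ y≡a₀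
      entry : ∀ {y} → RemoveVertex E a₀ y u → Reached y → SafeEntry
      entry {y} (yu , y≢a₀ , _) reachedY = y , reachedY , yu , y≢a₀

  -- Either a safe entry exists or a₀ is not an in-neighbour of u (classically;
  -- the double negation is harmless as it is only used to prove ⊥).
  safeEntryOrNoArc : ¬ (∃ λ v → E v u × ¬ Reach (RemoveVertex E v) r u)
                   → ¬ ¬ (SafeEntry ⊎ ¬ E a₀ u)
  safeEntryOrNoArc noSeparator k =
    k (inj₂ λ a₀u → noSeparator (a₀ , a₀u , λ w → k (inj₁ (safeEntryFromSeparation w))))

  unreachable : ¬ (∃ λ v → E v u × ¬ Reach (RemoveVertex E v) r u)
              → (x : Σ V (λ x → x ≢ u)) → ¬ Reach D'' r' x
              → (F : Rel V) → (∀ {y z} → F y z → E y z) → Avoids F a₀ b₀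
              → ¬ Reach F r (proj₁ x)
  unreachable noSeparator (x₀ , x₀≢u) noPath F F⊆E avoids w =
    safeEntryOrNoArc noSeparator λ safeOrNoArc →
      noPath (proj₁ (Lift.liftWalk F F⊆E avoids (entry safeOrNoArc) w rootLifted) x₀≢u)
    where
      entry : SafeEntry ⊎ ¬ E a₀ u → ∀ {y} → F y u → Reached y → SafeEntry
      entry (inj₁ safe) _ _ = safe
      entry (inj₂ noArc) {y} f reachedY = y , reachedY , F⊆E f , λ { refl → noArc (F⊆E f) }

lemma29 : (n : ℕ) (A : Fin n → Fin n → Bool) (r u : Fin n)
          → Loopless (Arc A)
          → (∀ x → ¬ Arc A x r)
          → Connected (Arc A) r
          → (∀ a b → IsCutEdge (Arc A) r a b → InDegOne (Arc A) b)
          → (ur : u ≢ r)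
          → ¬ Arc A r u
          → ¬ (∃ λ v → Arc A v u × ¬ Reach (RemoveVertex (Arc A) v) r u)
          → ∀ (a b : Σ (Fin n) (λ x → x ≢ u))
          → IsCutEdge (Shortcut (Arc A) u) (r , λ e → ur (sym e)) a b
          → Arc A (proj₁ a) (proj₁ b) × IsCutEdge (Arc A) r (proj₁ a) (proj₁ b)
lemma29 n A r u loopless _ conn _ ur _ noSeparator a b (_ , x , noPath) =
  arc , arc , proj₁ x , unreachableInD (RemoveArc (Arc A) a₀ b₀) proj₁ proj₂
  where
    open ShortcutLifting Fin._≟_ (Arc A) loopless r u ur a b
    unreachableInD = unreachable noSeparator x noPath
    -- if (a₀,b₀) were not an arc, D itself would avoid it, yet D reaches x
    arc : Arc A a₀ b₀
    arc = decidable-stable (A a₀ b₀ Bool.≟ true) λ noArc →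
      unreachableInD (Arc A) id (λ { f (refl , refl) → noArc f }) (conn (proj₁ x))
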